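{- Let $n\geq 3$ and let $C_n$ be the cycle on $n$ vertices. For every integer $k$ with $1\leq k<n/2$, the graph $\mathsf{TS}_k(C_n)$ is Eulerian.
   Context: All graphs are finite, simple and undirected. A graph is Eulerian if it has a closed walk traversing every edge exactly once; equivalently, it is connected and every vertex has even degree. An independent set of a graph is a set of pairwise non-adjacent vertices. For a positive integer $k$, $\mathsf{TS}_k(G)$ is the graph whose vertices are the independent sets of $G$ of size exactly $k$, two sets $I,J$ being adjacent iff there exist $u,v\in V(G)$ with $I\setminus J=\{u\}$, $J\setminus I=\{v\}$ and $uv\in E(G)$. -}

module Defs where

open import Data.Nat using (ℕ; zero; suc; _+_; _*_)
open import Data.Nat.Divisibility using (_∣_)
open import Data.Fin using (Fin; toℕ)
open import Data.Fin.Subset using (Subset; _∈_; _─_; ⁅_⁆; ∣_∣)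
open import Data.List using (List; length)
import Data.List.Membership.Propositional as LM
open import Data.List.Relation.Unary.Unique.Propositional using (Unique)
open import Data.Product using (Σ; ∃; ∃-syntax; _×_)
open import Data.Sum using (_⊎_)
open import Relation.Nullary using (¬_)
open import Relation.Binary.PropositionalEquality using (_≡_)
open import Relation.Binary.Construct.Closure.ReflexiveTransitive using (Star)
open import Function.Bundles using (_⇔_)

CycleSucc : (n : ℕ) → Fin n → Fin n → Set
CycleSucc n u v = (suc (toℕ u) ≡ toℕ v) ⊎ ((suc (toℕ u) ≡ n) × (toℕ v ≡ 0))

CycleAdj : (n : ℕ) → Fin n → Fin n → Set
CycleAdj n u v = CycleSucc n u v ⊎ CycleSucc n v u

Independent : (n : ℕ) → Subset n → Set
Independent n I = ∀ u v → u ∈ I → v ∈ I → ¬ CycleAdj n u v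

IsTSVertex : (n k : ℕ) → Subset n → Set
IsTSVertex n k I = Independent n I × (∣ I ∣ ≡ k)

TSAdj : (n : ℕ) → Subset n → Subset n → Set
TSAdj n I J = ∃[ u ] ∃[ v ] ((I ─ J ≡ ⁅ u ⁆) × (J ─ I ≡ ⁅ v ⁆) × CycleAdj n u v)

TSEdge : (n k : ℕ) → Subset n → Subset n → Set
TSEdge n k I J = IsTSVertex n k I × IsTSVertex n k J × TSAdj n I J

Connected : (n k : ℕ) → Set
Connected n k =
  (∃[ I ] IsTSVertex n k I) ×
  (∀ I J → IsTSVertex n k I → IsTSVertex n k J → Star (TSEdge n k) I J)

EvenDegree : (n k : ℕ) → Subset n → Set
EvenDegree n k I =
  ∃[ L ] (Unique L × (∀ J → (J LM.∈ L) ⇔ TSEdge n k I J) × (2 ∣ length L))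

TSEulerian : (n k : ℕ) → Set
TSEulerian n k = Connected n k × (∀ I → IsTSVertex n k I → EvenDegree n k I)

-- The neighbours of I are obtained by sliding a token u ∈ I to u + 1, possible exactly when
-- u + 2 ∉ I (u + 1 ∉ I by independence), or to u - 1, possible exactly when u - 2 ∉ I. Rotation
-- by two positions is a bijection of C_n, so #{u ∈ I | u + 2 ∈ I} = #{u ∈ I | u - 2 ∈ I};
-- subtracting from |I|, both kinds of moves are equally many and the degree of I is even.
-- For connectivity, slide tokens towards 0: moving a token u ≠ 0 to u - 1 lowers Σ_{u ∈ I} u.
-- When no such move is possible, every token u ≠ 0 has u - 2 ∈ I, so I contains all positions of
-- the same parity below each of its tokens. Since 2k < n this forces 0 ∈ I and then
-- I = {0, 2, …, 2k - 2}, which is therefore reachable from every vertex.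
module Submission where

open import Data.Bool.Base using (true; false; _∧_; not; if_then_else_)
open import Data.Bool.Properties using (¬-not; ∧-zeroʳ; ∧-identityʳ; ∧-inverseʳ)
open import Data.Empty using (⊥-elim)
open import Data.Fin.Base using (Fin; zero; suc; toℕ; fromℕ; inject₁)
open import Data.Fin.Permutation using (permutation)
import Data.Fin.Properties as Fin
open import Data.Fin.Properties using (_≟_; toℕ<n; toℕ-injective; toℕ-fromℕ; toℕ-inject₁)
open import Data.Fin.Relation.Unary.Top using (View; view; ‵fromℕ; ‵inject₁; view-fromℕ; view-inject₁)
open import Data.Fin.Subset
  using (Subset; inside; outside; _∈_; _∉_; _⊆_; _─_; _-_; _∩_; ⁅_⁆; ∣_∣; Nonempty) renaming (⊥ to ∅)
open import Data.Fin.Subset.Properties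
  using ( _∈?_; nonempty?; ∉⊥; x∈⁅x⁆; x∉⁅y⁆⇒x≢y; x∈p∧x∉q⇒x∈p─q; x∈p∧x≢y⇒x∈p-y; p─q⊆p; ⊆-antisym; ∩-comm
        ; p⊆q⇒∣p∣≤∣q∣; p⊂q⇒∣p∣<∣q∣; Empty-unique; ∣⊥∣≡0)
open import Data.List.Base as List using (List; []; _∷_; _++_; length)
open import Data.List.Membership.Propositional using () renaming (_∈_ to _∈ˡ_)
open import Data.List.Membership.Propositional.Properties using (∈-map⁺; ∈-map⁻; ∈-++⁺ˡ; ∈-++⁺ʳ; ∈-++⁻)
open import Data.List.Properties using (length-map; length-++)
import Data.List.Relation.Unary.All as All
import Data.List.Relation.Unary.All.Properties as All
open import Data.List.Relation.Unary.AllPairs using ([]; _∷_)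
open import Data.List.Relation.Unary.Any using (here; there)
open import Data.List.Relation.Unary.Unique.Propositional using (Unique)
import Data.List.Relation.Unary.Unique.Propositional.Properties as Unique
open import Data.Nat.Base using (ℕ; zero; suc; _+_; _*_; _∸_; _≤_; _<_; z≤n; s≤s)
open import Data.Nat.Divisibility using (_∣_; divides)
open import Data.Nat.Induction using (<-wellFounded)
open import Data.Nat.Properties
  using ( suc-injective; 0≢1+n; 1+n≢n; m≢1+n+m; even≢odd; _<?_; ≤-reflexive; ≤-trans; ≤-pred; n≤1+n
        ; m≤n⇒m≤1+n; <⇒≤; <⇒≢; >⇒≢; ≤⇒≯; 1+n≰n; <-≤-trans; +-comm; +-assoc; +-identityʳ; +-suc
        ; +-cancelʳ-≡; *-comm; *-distribʳ-+; *-monoˡ-≤; *-monoˡ-<; m+[n∸m]≡n; +-0-commutativeMonoid)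
open import Algebra.Properties.CommutativeMonoid.Sum +-0-commutativeMonoid using (sum; sum-cong-≗; ∑-permute)
open import Data.Product using (_×_; _,_; proj₁; proj₂; uncurry; ∃-syntax)
open import Data.Sum using (_⊎_; inj₁; inj₂; [_,_]; swap)
open import Data.Vec.Base using ([]; _∷_; here; there; lookup; tabulate; _[_]≔_)
open import Data.Vec.Properties
  using ( lookup∘tabulate; tabulate∘lookup; tabulate-cong; lookup∘update; lookup∘update′; lookup-replicate
        ; []=⇒lookup; lookup⇒[]=)
open import Function.Base using (_∘_)
open import Function.Bundles using (mk⇔)
open import Induction.WellFounded using (Acc; acc)
open import Relation.Binary.Construct.Closure.ReflexiveTransitive using (Star; ε; _◅_; _◅◅_; reverse)
open import Relation.Binary.PropositionalEquality
  using (_≡_; _≢_; refl; sym; trans; cong; cong₂; subst; module ≡-Reasoning)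
open import Relation.Nullary using (¬_; does; yes; no; contradiction)
open import Relation.Nullary.Decidable using (dec-false)

open import Defs

private variable n : ℕ

-- Subsets of Fin n

true≢false : true ≢ false
true≢false ()

lookup-injective : {p q : Subset n} → (∀ x → lookup p x ≡ lookup q x) → p ≡ q
lookup-injective {p = p} {q} eq = begin
  p                   ≡⟨ tabulate∘lookup p ⟨
  tabulate (lookup p) ≡⟨ tabulate-cong eq ⟩
  tabulate (lookup q) ≡⟨ tabulate∘lookup q ⟩
  q                   ∎
  where open ≡-Reasoning

∉⇒lookup≡outside : {x : Fin n} {p : Subset n} → x ∉ p → lookup p x ≡ outside
∉⇒lookup≡outside {x = x} {p} x∉p = ¬-not (x∉p ∘ lookup⇒[]= x p)

∈∧∉⇒≢ : {u v : Fin n} {p : Subset n} → u ∈ p → v ∉ p → u ≢ v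
∈∧∉⇒≢ u∈p v∉p refl = v∉p u∈p

lookup-─ : ∀ (p q : Subset n) x → lookup (p ─ q) x ≡ lookup p x ∧ not (lookup q x)
lookup-─ (a ∷ p) (true  ∷ q) zero    = sym (∧-zeroʳ a)
lookup-─ (a ∷ p) (false ∷ q) zero    = sym (∧-identityʳ a)
lookup-─ (a ∷ p) (b     ∷ q) (suc x) = lookup-─ p q x

lookup-⁅⁆ : ∀ (u x : Fin n) → lookup ⁅ u ⁆ x ≡ does (x ≟ u)
lookup-⁅⁆ zero    zero    = refl
lookup-⁅⁆ zero    (suc x) = lookup-replicate x outside
lookup-⁅⁆ (suc u) zero    = refl
lookup-⁅⁆ (suc u) (suc x) = lookup-⁅⁆ u x

∈-─⁻ : ∀ {p q : Subset n} {x} → x ∈ p ─ q → x ∈ p × x ∉ q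
∈-─⁻ {p = p} {q} {x} x∈p─q = p─q⊆p p q x∈p─q , λ x∈q → true≢false (begin
  true                           ≡⟨ []=⇒lookup x∈p─q ⟨
  lookup (p ─ q) x               ≡⟨ lookup-─ p q x ⟩
  lookup p x ∧ not (lookup q x)  ≡⟨ cong (λ b → lookup p x ∧ not b) ([]=⇒lookup x∈q) ⟩
  lookup p x ∧ false             ≡⟨ ∧-zeroʳ (lookup p x) ⟩
  false                          ∎)
  where open ≡-Reasoning

∣p∣≡∣p─q∣+∣p∩q∣ : ∀ (p q : Subset n) → ∣ p ∣ ≡ ∣ p ─ q ∣ + ∣ p ∩ q ∣
∣p∣≡∣p─q∣+∣p∩q∣ []            []            = refl
∣p∣≡∣p─q∣+∣p∩q∣ (inside  ∷ p) (inside  ∷ q) = trans (cong suc (∣p∣≡∣p─q∣+∣p∩q∣ p q)) (sym (+-suc _ _))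
∣p∣≡∣p─q∣+∣p∩q∣ (inside  ∷ p) (outside ∷ q) = cong suc (∣p∣≡∣p─q∣+∣p∩q∣ p q)
∣p∣≡∣p─q∣+∣p∩q∣ (outside ∷ p) (inside  ∷ q) = ∣p∣≡∣p─q∣+∣p∩q∣ p q
∣p∣≡∣p─q∣+∣p∩q∣ (outside ∷ p) (outside ∷ q) = ∣p∣≡∣p─q∣+∣p∩q∣ p q

∣p∣≡∣q∣⇒∣p─q∣≡∣q─p∣ : ∀ {p q : Subset n} → ∣ p ∣ ≡ ∣ q ∣ → ∣ p ─ q ∣ ≡ ∣ q ─ p ∣
∣p∣≡∣q∣⇒∣p─q∣≡∣q─p∣ {p = p} {q} ∣p∣≡∣q∣ = +-cancelʳ-≡ ∣ p ∩ q ∣ _ _ (begin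
  ∣ p ─ q ∣ + ∣ p ∩ q ∣ ≡⟨ ∣p∣≡∣p─q∣+∣p∩q∣ p q ⟨
  ∣ p ∣                 ≡⟨ ∣p∣≡∣q∣ ⟩
  ∣ q ∣                 ≡⟨ ∣p∣≡∣p─q∣+∣p∩q∣ q p ⟩
  ∣ q ─ p ∣ + ∣ q ∩ p ∣ ≡⟨ cong (λ r → ∣ q ─ p ∣ + ∣ r ∣) (∩-comm q p) ⟩
  ∣ q ─ p ∣ + ∣ p ∩ q ∣ ∎)
  where open ≡-Reasoning

p⊆q⇒∣q∣≤∣p∣⇒p≡q : ∀ {p q : Subset n} → p ⊆ q → ∣ q ∣ ≤ ∣ p ∣ → p ≡ q
p⊆q⇒∣q∣≤∣p∣⇒p≡q {p = p} p⊆q ∣q∣≤∣p∣ = ⊆-antisym p⊆q q⊆p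
  where
  q⊆p : _ ⊆ p
  q⊆p {x} x∈q with x ∈? p
  ... | yes x∈p = x∈p
  ... | no  x∉p = contradiction (p⊂q⇒∣p∣<∣q∣ (p⊆q , x , x∈q , x∉p)) (≤⇒≯ ∣q∣≤∣p∣)

∣p∣≢0⇒Nonempty : ∀ {p : Subset n} → ∣ p ∣ ≢ 0 → Nonempty p
∣p∣≢0⇒Nonempty {n} {p} ∣p∣≢0 with nonempty? p
... | yes p≢∅ = p≢∅
... | no  p≡∅ = contradiction (trans (cong ∣_∣ (Empty-unique p≡∅)) (∣⊥∣≡0 n)) ∣p∣≢0

weight : (Fin n → ℕ) → Subset n → ℕ
weight w p = sum (λ i → if lookup p i then w i else 0)

∣p∣≡weight-1 : ∀ (p : Subset n) → ∣ p ∣ ≡ weight (λ _ → 1) p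
∣p∣≡weight-1 []            = refl
∣p∣≡weight-1 (inside  ∷ p) = cong suc (∣p∣≡weight-1 p)
∣p∣≡weight-1 (outside ∷ p) = ∣p∣≡weight-1 p

weight-update : ∀ (w : Fin n → ℕ) p j b →
                weight w (p [ j ]≔ b) + (if lookup p j then w j else 0) ≡ weight w p + (if b then w j else 0)
weight-update w (a ∷ p) zero b = begin
  (B + W) + A ≡⟨ +-assoc B W A ⟩
  B + (W + A) ≡⟨ cong (B +_) (+-comm W A) ⟩
  B + (A + W) ≡⟨ +-comm B (A + W) ⟩
  (A + W) + B ∎
  where
  open ≡-Reasoning
  A B W : ℕ
  A = if a then w zero else 0
  B = if b then w zero else 0
  W = weight (w ∘ suc) p
weight-update w (a ∷ p) (suc j) b = begin
  (A + weight (w ∘ suc) (p [ j ]≔ b)) + C ≡⟨ +-assoc A _ C ⟩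
  A + (weight (w ∘ suc) (p [ j ]≔ b) + C) ≡⟨ cong (A +_) (weight-update (w ∘ suc) p j b) ⟩
  A + (weight (w ∘ suc) p + B)            ≡⟨ +-assoc A _ B ⟨
  (A + weight (w ∘ suc) p) + B            ∎
  where
  open ≡-Reasoning
  A B C : ℕ
  A = if a then w zero else 0
  B = if b then w (suc j) else 0
  C = if lookup p j then w (suc j) else 0

preimage : ∀ {m} → (Fin m → Fin n) → Subset n → Subset m
preimage σ p = tabulate (lookup p ∘ σ)

module _ {m} {σ : Fin m → Fin n} where

  lookup-preimage : ∀ p x → lookup (preimage σ p) x ≡ lookup p (σ x)
  lookup-preimage p = lookup∘tabulate (lookup p ∘ σ)

  ∈-preimage⁻ : ∀ {p x} → x ∈ preimage σ p → σ x ∈ p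
  ∈-preimage⁻ {p} {x} x∈ = lookup⇒[]= (σ x) p (trans (sym (lookup-preimage p x)) ([]=⇒lookup x∈))

  ∈-preimage⁺ : ∀ {p x} → σ x ∈ p → x ∈ preimage σ p
  ∈-preimage⁺ {p} {x} σx∈ = lookup⇒[]= x (preimage σ p) (trans (lookup-preimage p x) ([]=⇒lookup σx∈))

  preimage-─ : ∀ p q → preimage σ (p ─ q) ≡ preimage σ p ─ preimage σ q
  preimage-─ p q = lookup-injective λ x → begin
    lookup (preimage σ (p ─ q)) x
      ≡⟨ lookup-preimage (p ─ q) x ⟩
    lookup (p ─ q) (σ x)
      ≡⟨ lookup-─ p q (σ x) ⟩
    lookup p (σ x) ∧ not (lookup q (σ x))
      ≡⟨ cong₂ (λ a b → a ∧ not b) (lookup-preimage p x) (lookup-preimage q x) ⟨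
    lookup (preimage σ p) x ∧ not (lookup (preimage σ q) x)
      ≡⟨ lookup-─ (preimage σ p) (preimage σ q) x ⟨
    lookup (preimage σ p ─ preimage σ q) x
      ∎
    where open ≡-Reasoning

∈-─preimage⁻ : ∀ {m} (σ : Fin m → Fin n) {p : Subset m} {q x} → x ∈ p ─ preimage σ q → x ∈ p × σ x ∉ q
∈-─preimage⁻ σ x∈ with x∈p , x∉σ⁻¹q ← ∈-─⁻ x∈ = x∈p , x∉σ⁻¹q ∘ ∈-preimage⁺

∈-─preimage⁺ : ∀ {m} (σ : Fin m → Fin n) {p : Subset m} {q x} → x ∈ p → σ x ∉ q → x ∈ p ─ preimage σ q
∈-─preimage⁺ σ x∈p σx∉q = x∈p∧x∉q⇒x∈p─q x∈p (σx∉q ∘ ∈-preimage⁻)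

preimage-∘ : ∀ (σ τ : Fin n → Fin n) p → preimage σ (preimage τ p) ≡ preimage (τ ∘ σ) p
preimage-∘ σ τ p = lookup-injective λ x →
  trans (lookup-preimage (preimage τ p) x) (trans (lookup-preimage p (σ x)) (sym (lookup-preimage p x)))

preimage-id : ∀ {σ : Fin n → Fin n} → (∀ x → σ x ≡ x) → ∀ p → preimage σ p ≡ p
preimage-id σ≗id p = lookup-injective λ x → trans (lookup-preimage p x) (cong (lookup p) (σ≗id x))

∣preimage∣≡∣p∣ : ∀ {σ τ : Fin n → Fin n} → (∀ x → σ (τ x) ≡ x) → (∀ x → τ (σ x) ≡ x) →
                 ∀ p → ∣ preimage σ p ∣ ≡ ∣ p ∣
∣preimage∣≡∣p∣ {n} {σ} {τ} στ≗id τσ≗id p = begin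
  ∣ preimage σ p ∣
    ≡⟨ ∣p∣≡weight-1 (preimage σ p) ⟩
  sum (λ i → if lookup (preimage σ p) i then 1 else 0)
    ≡⟨ sum-cong-≗ {n} (λ i → cong (λ b → if b then 1 else 0) (lookup-preimage p i)) ⟩
  sum (λ i → if lookup p (σ i) then 1 else 0)
    ≡⟨ ∑-permute (λ i → if lookup p i then 1 else 0) (permutation σ τ στ≗id τσ≗id) ⟨
  weight (λ _ → 1) p
    ≡⟨ ∣p∣≡weight-1 p ⟨
  ∣ p ∣
    ∎
  where open ≡-Reasoning

elements : Subset n → List (Fin n)
elements []            = []
elements (inside  ∷ p) = zero ∷ List.map suc (elements p)
elements (outside ∷ p) = List.map suc (elements p)

length-elements : ∀ (p : Subset n) → length (elements p) ≡ ∣ p ∣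
length-elements []            = refl
length-elements (inside  ∷ p) = cong suc (trans (length-map suc (elements p)) (length-elements p))
length-elements (outside ∷ p) = trans (length-map suc (elements p)) (length-elements p)

∈-elements⁺ : ∀ {p : Subset n} {x} → x ∈ p → x ∈ˡ elements p
∈-elements⁺                   here        = here refl
∈-elements⁺ {p = inside  ∷ p} (there x∈p) = there (∈-map⁺ suc (∈-elements⁺ x∈p))
∈-elements⁺ {p = outside ∷ p} (there x∈p) = ∈-map⁺ suc (∈-elements⁺ x∈p)

∈-elements⁻ : ∀ {p : Subset n} {x} → x ∈ˡ elements p → x ∈ p
∈-elements⁻ {p = inside  ∷ p} (here refl) = here
∈-elements⁻ {p = inside  ∷ p} (there x∈)  with _ , y∈ , refl ← ∈-map⁻ suc x∈ = there (∈-elements⁻ y∈)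
∈-elements⁻ {p = outside ∷ p} x∈          with _ , y∈ , refl ← ∈-map⁻ suc x∈ = there (∈-elements⁻ y∈)

elements-unique : ∀ (p : Subset n) → Unique (elements p)
elements-unique []            = []
elements-unique (inside  ∷ p) =
  All.map⁺ (All.universal (λ _ ()) (elements p)) ∷ Unique.map⁺ Fin.suc-injective (elements-unique p)
elements-unique (outside ∷ p) = Unique.map⁺ Fin.suc-injective (elements-unique p)

map⁺-injectiveOn : ∀ {A B : Set} {f : A → B} {xs : List A} →
                   (∀ {x y} → x ∈ˡ xs → y ∈ˡ xs → f x ≡ f y → x ≡ y) → Unique xs → Unique (List.map f xs)
map⁺-injectiveOn inj []           = []
map⁺-injectiveOn inj (x∉xs ∷ xs!) =
  All.map⁺ (All.tabulate λ y∈ fx≡fy → All.lookup x∉xs y∈ (inj (here refl) (there y∈) fx≡fy))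
  ∷ map⁺-injectiveOn (λ x∈ y∈ → inj (there x∈) (there y∈)) xs!

-- Sliding a token

slide : Subset n → Fin n → Fin n → Subset n
slide I u v = I [ u ]≔ outside [ v ]≔ inside

module _ {I : Subset n} {u v : Fin n} where

  lookup-slide-target : lookup (slide I u v) v ≡ inside
  lookup-slide-target = lookup∘update v (I [ u ]≔ outside) inside

  lookup-slide-source : u ≢ v → lookup (slide I u v) u ≡ outside
  lookup-slide-source u≢v = trans (lookup∘update′ u≢v (I [ u ]≔ outside) inside) (lookup∘update u I outside)

  lookup-slide-other : ∀ {x} → x ≢ u → x ≢ v → lookup (slide I u v) x ≡ lookup I x
  lookup-slide-other x≢u x≢v =
    trans (lookup∘update′ x≢v (I [ u ]≔ outside) inside) (lookup∘update′ x≢u I outside)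

  target∈slide : v ∈ slide I u v
  target∈slide = lookup⇒[]= v (slide I u v) lookup-slide-target

  module _ (u∈I : u ∈ I) (v∉I : v ∉ I) where

    private
      u≢v : u ≢ v
      u≢v = ∈∧∉⇒≢ u∈I v∉I

    ∈slide⇒∈ : ∀ {x} → x ∈ slide I u v → x ≢ v → x ≢ u × x ∈ I
    ∈slide⇒∈ {x} x∈J x≢v = x≢u , lookup⇒[]= x I (trans (sym (lookup-slide-other x≢u x≢v)) ([]=⇒lookup x∈J))
      where
      x≢u : x ≢ u
      x≢u refl = true≢false (trans (sym ([]=⇒lookup x∈J)) (lookup-slide-source u≢v))

    ∈⇒∈slide : ∀ {x} → x ∈ I → x ≢ u → x ∈ slide I u v
    ∈⇒∈slide {x} x∈I x≢u =
      lookup⇒[]= x (slide I u v) (trans (lookup-slide-other x≢u (∈∧∉⇒≢ x∈I v∉I)) ([]=⇒lookup x∈I))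

    weight-slide : ∀ w → weight w (slide I u v) + w u ≡ weight w I + w v
    weight-slide w = begin
      weight w (slide I u v) + w u ≡⟨ cong (_+ w u) inserted ⟩
      (weight w T + w v) + w u    ≡⟨ +-assoc (weight w T) (w v) (w u) ⟩
      weight w T + (w v + w u)    ≡⟨ cong (weight w T +_) (+-comm (w v) (w u)) ⟩
      weight w T + (w u + w v)    ≡⟨ +-assoc (weight w T) (w u) (w v) ⟨
      (weight w T + w u) + w v    ≡⟨ cong (_+ w v) removed ⟩
      weight w I + w v            ∎
      where
      open ≡-Reasoning
      T : Subset n
      T = I [ u ]≔ outside
      inserted : weight w (slide I u v) ≡ weight w T + w v
      inserted = trans (sym (+-identityʳ _))
        (subst (λ b → weight w (slide I u v) + (if b then w v else 0) ≡ weight w T + w v)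
               (trans (lookup∘update′ (u≢v ∘ sym) I outside) (∉⇒lookup≡outside v∉I))
               (weight-update w T v inside))
      removed : weight w T + w u ≡ weight w I
      removed = trans (subst (λ b → weight w T + (if b then w u else 0) ≡ weight w I + 0)
                             ([]=⇒lookup u∈I) (weight-update w I u outside))
                      (+-identityʳ _)

    ∣slide∣≡∣I∣ : ∣ slide I u v ∣ ≡ ∣ I ∣
    ∣slide∣≡∣I∣ = begin
      ∣ slide I u v ∣                ≡⟨ ∣p∣≡weight-1 (slide I u v) ⟩
      weight (λ _ → 1) (slide I u v) ≡⟨ +-cancelʳ-≡ 1 _ _ (weight-slide (λ _ → 1)) ⟩
      weight (λ _ → 1) I             ≡⟨ ∣p∣≡weight-1 I ⟨
      ∣ I ∣                          ∎
      where open ≡-Reasoning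

    I─slide≡⁅u⁆ : I ─ slide I u v ≡ ⁅ u ⁆
    I─slide≡⁅u⁆ = lookup-injective λ x →
      trans (lookup-─ I (slide I u v) x) (trans (pointwise x) (sym (lookup-⁅⁆ u x)))
      where
      pointwise : ∀ x → lookup I x ∧ not (lookup (slide I u v) x) ≡ does (x ≟ u)
      pointwise x with x ≟ u | x ≟ v
      ... | yes refl | _        rewrite lookup-slide-source u≢v | []=⇒lookup u∈I = refl
      ... | no _     | yes refl rewrite lookup-slide-target = ∧-zeroʳ (lookup I x)
      ... | no x≢u   | no x≢v   rewrite lookup-slide-other x≢u x≢v = ∧-inverseʳ (lookup I x)

    slide─I≡⁅v⁆ : slide I u v ─ I ≡ ⁅ v ⁆
    slide─I≡⁅v⁆ = lookup-injective λ x →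
      trans (lookup-─ (slide I u v) I x) (trans (pointwise x) (sym (lookup-⁅⁆ v x)))
      where
      pointwise : ∀ x → lookup (slide I u v) x ∧ not (lookup I x) ≡ does (x ≟ v)
      pointwise x with x ≟ v | x ≟ u
      ... | yes refl | _        rewrite lookup-slide-target | ∉⇒lookup≡outside v∉I = refl
      ... | no _     | yes refl rewrite lookup-slide-source u≢v = refl
      ... | no x≢v   | no x≢u   rewrite lookup-slide-other x≢u x≢v = ∧-inverseʳ (lookup I x)

─≡⁅⁆⇒slide : ∀ {I J : Subset n} {u v} → I ─ J ≡ ⁅ u ⁆ → J ─ I ≡ ⁅ v ⁆ → u ∈ I × v ∉ I × J ≡ slide I u v
─≡⁅⁆⇒slide {I = I} {J} {u} {v} I─J≡⁅u⁆ J─I≡⁅v⁆ = u∈I , v∉I , lookup-injective J≗slide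
  where
  u∈I∖J : u ∈ I × u ∉ J
  u∈I∖J = ∈-─⁻ (subst (u ∈_) (sym I─J≡⁅u⁆) (x∈⁅x⁆ u))
  v∈J∖I : v ∈ J × v ∉ I
  v∈J∖I = ∈-─⁻ (subst (v ∈_) (sym J─I≡⁅v⁆) (x∈⁅x⁆ v))
  u∈I : u ∈ I
  u∈I = proj₁ u∈I∖J
  v∉I : v ∉ I
  v∉I = proj₂ v∈J∖I
  not-removed : ∀ {p q : Subset n} {w x} → p ─ q ≡ ⁅ w ⁆ → x ≢ w → lookup p x ∧ not (lookup q x) ≡ false
  not-removed {p = p} {q} {w} {x} p─q≡⁅w⁆ x≢w =
    trans (sym (lookup-─ p q x))
          (trans (cong (λ r → lookup r x) p─q≡⁅w⁆) (trans (lookup-⁅⁆ w x) (dec-false (x ≟ w) x≢w)))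
  unchanged : ∀ {a b} → a ∧ not b ≡ false → b ∧ not a ≡ false → b ≡ a
  unchanged {true}  {true}  _ _ = refl
  unchanged {false} {false} _ _ = refl
  J≗slide : ∀ x → lookup J x ≡ lookup (slide I u v) x
  J≗slide x with x ≟ v | x ≟ u
  ... | yes refl | _        = trans ([]=⇒lookup (proj₁ v∈J∖I)) (sym (lookup-slide-target {I = I} {u}))
  ... | no _     | yes refl = trans (∉⇒lookup≡outside (proj₂ u∈I∖J))
                                    (sym (lookup-slide-source {I = I} (∈∧∉⇒≢ u∈I v∉I)))
  ... | no x≢v   | no x≢u   = trans (unchanged (not-removed I─J≡⁅u⁆ x≢u) (not-removed J─I≡⁅v⁆ x≢v))
                                    (sym (lookup-slide-other {I = I} x≢u x≢v))

slide-injective : ∀ {I : Subset n} {u v u′ v′} → u ∈ I → v ∉ I → u′ ∈ I → v′ ∉ I →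
                  slide I u v ≡ slide I u′ v′ → u ≡ u′ × v ≡ v′
slide-injective {I = I} {u} {v} {u′} {v′} u∈I v∉I u′∈I v′∉I eq = same-source , same-target
  where
  same-source : u ≡ u′
  same-source with u ≟ u′
  ... | yes u≡u′ = u≡u′
  ... | no  u≢u′ = ⊥-elim (proj₁ (∈slide⇒∈ u′∈I v′∉I u′∈J′ (∈∧∉⇒≢ u′∈I v′∉I)) refl)
    where u′∈J′ = subst (u′ ∈_) eq (∈⇒∈slide u∈I v∉I u′∈I (u≢u′ ∘ sym))
  same-target : v ≡ v′
  same-target with v ≟ v′
  ... | yes v≡v′ = v≡v′
  ... | no  v≢v′ = contradiction (proj₂ (∈slide⇒∈ u′∈I v′∉I (subst (v ∈_) eq target∈slide) v≢v′)) v∉I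

slide-TSEdge : ∀ {n k} {I : Subset n} {u v} → IsTSVertex n k I → u ∈ I → v ∉ I → CycleAdj n u v →
               Independent n (slide I u v) → TSEdge n k I (slide I u v)
slide-TSEdge (I-ind , ∣I∣≡k) u∈I v∉I u~v J-ind =
  (I-ind , ∣I∣≡k) , (J-ind , trans (∣slide∣≡∣I∣ u∈I v∉I) ∣I∣≡k) ,
  (_ , _ , I─slide≡⁅u⁆ u∈I v∉I , slide─I≡⁅v⁆ u∈I v∉I , u~v)

TSEdge-sym : ∀ {n k I J} → TSEdge n k I J → TSEdge n k J I
TSEdge-sym (I-vert , J-vert , (u , v , I─J , J─I , u~v)) = J-vert , I-vert , (v , u , J─I , I─J , swap u~v)

-- The cycle C_{m+1} on Fin (suc m)

module _ {m : ℕ} where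

  private
    next-view : {i : Fin (suc m)} → View i → Fin (suc m)
    next-view ‵fromℕ       = zero
    next-view (‵inject₁ j) = suc j

  next : Fin (suc m) → Fin (suc m)
  next i = next-view (view i)

  prev : Fin (suc m) → Fin (suc m)
  prev zero    = fromℕ m
  prev (suc j) = inject₁ j

  prev-next : ∀ i → prev (next i) ≡ i
  prev-next i with view i
  ... | ‵fromℕ     = refl
  ... | ‵inject₁ _ = refl

  next-prev : ∀ i → next (prev i) ≡ i
  next-prev zero    = cong next-view (view-fromℕ m)
  next-prev (suc j) = cong next-view (view-inject₁ j)

  toℕ-prev : ∀ {u : Fin (suc m)} {x} → toℕ u ≡ suc x → toℕ (prev u) ≡ x
  toℕ-prev {u = suc j} eq = trans (toℕ-inject₁ j) (suc-injective eq)

  CycleSucc-prev : ∀ v → CycleSucc (suc m) (prev v) v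
  CycleSucc-prev zero    = inj₂ (cong suc (toℕ-fromℕ m) , refl)
  CycleSucc-prev (suc j) = inj₁ (cong suc (toℕ-inject₁ j))

  CycleSucc-next : ∀ u → CycleSucc (suc m) u (next u)
  CycleSucc-next u = subst (λ w → CycleSucc (suc m) w (next u)) (prev-next u) (CycleSucc-prev (next u))

  CycleSucc⇒≡prev : ∀ {u v} → CycleSucc (suc m) u v → u ≡ prev v
  CycleSucc⇒≡prev {v = zero}  (inj₂ (1+u≡1+m , _)) =
    toℕ-injective (trans (suc-injective 1+u≡1+m) (sym (toℕ-fromℕ m)))
  CycleSucc⇒≡prev {v = suc j} (inj₁ 1+u≡1+j) =
    toℕ-injective (trans (suc-injective 1+u≡1+j) (sym (toℕ-inject₁ j)))

  CycleAdj-next : ∀ u → CycleAdj (suc m) u (next u)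
  CycleAdj-next u = inj₁ (CycleSucc-next u)

  CycleAdj-prev : ∀ u → CycleAdj (suc m) u (prev u)
  CycleAdj-prev u = inj₂ (CycleSucc-prev u)

  CycleAdj⇒next⊎prev : ∀ {u v} → CycleAdj (suc m) u v → v ≡ next u ⊎ v ≡ prev u
  CycleAdj⇒next⊎prev {v = v} (inj₁ u→v) =
    inj₁ (trans (sym (next-prev v)) (cong next (sym (CycleSucc⇒≡prev u→v))))
  CycleAdj⇒next⊎prev         (inj₂ v→u) = inj₂ (CycleSucc⇒≡prev v→u)

prev≢id : ∀ {m} → 1 ≤ m → (u : Fin (suc m)) → prev u ≢ u
prev≢id (s≤s _) zero    ()
prev≢id _       (suc j) eq = 1+n≢n (sym (trans (sym (toℕ-inject₁ j)) (cong toℕ eq)))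

prev∘prev≢id : ∀ {m} → 2 ≤ m → (u : Fin (suc m)) → prev (prev u) ≢ u
prev∘prev≢id (s≤s (s≤s _)) zero          ()
prev∘prev≢id (s≤s (s≤s _)) (suc zero)    ()
prev∘prev≢id _             (suc (suc j)) eq =
  m≢1+n+m (toℕ j) (trans (sym (trans (toℕ-inject₁ (inject₁ j)) (toℕ-inject₁ j))) (cong toℕ eq))

next≢id : ∀ {m} → 1 ≤ m → (u : Fin (suc m)) → next u ≢ u
next≢id 1≤m u eq = prev≢id 1≤m u (trans (cong prev (sym eq)) (prev-next u))

next∘next≢id : ∀ {m} → 2 ≤ m → (u : Fin (suc m)) → next (next u) ≢ u
next∘next≢id 2≤m u eq = prev∘prev≢id 2≤m u (begin
  prev (prev u)               ≡⟨ cong (prev ∘ prev) eq ⟨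
  prev (prev (next (next u))) ≡⟨ cong prev (prev-next (next u)) ⟩
  prev (next u)               ≡⟨ prev-next u ⟩
  u                           ∎)
  where open ≡-Reasoning

toℕ-next-zero : ∀ {m} → 1 ≤ m → toℕ (next {m} zero) ≡ 1
toℕ-next-zero {m} 1≤m with CycleSucc-next {m} zero
... | inj₁ 1≡next = sym 1≡next
... | inj₂ (1≡1+m , _) = contradiction (suc-injective 1≡1+m) (<⇒≢ 1≤m)

CycleAdj-irrefl : ∀ {m} → 1 ≤ m → (u : Fin (suc m)) → ¬ CycleAdj (suc m) u u
CycleAdj-irrefl 1≤m u u~u with CycleAdj⇒next⊎prev u~u
... | inj₁ u≡next = next≢id 1≤m u (sym u≡next)
... | inj₂ u≡prev = prev≢id 1≤m u (sym u≡prev)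

adjacent⇒∉ : ∀ {m} {I : Subset (suc m)} {u v} → Independent (suc m) I → u ∈ I → CycleAdj (suc m) u v → v ∉ I
adjacent⇒∉ I-ind u∈I u~v v∈I = I-ind _ _ u∈I v∈I u~v

module _ {m} {I : Subset (suc m)} {u v : Fin (suc m)} (u∈I : u ∈ I) (v∉I : v ∉ I) where

  slide-independent : 1 ≤ m → Independent (suc m) I → (∀ w → CycleAdj (suc m) v w → w ≢ u → w ∉ I) →
                      Independent (suc m) (slide I u v)
  slide-independent 1≤m I-ind free a b a∈J b∈J a~b with a ≟ v | b ≟ v
  ... | yes refl | yes refl = CycleAdj-irrefl 1≤m a a~b
  ... | yes refl | no b≢v   = uncurry (free b a~b) (∈slide⇒∈ u∈I v∉I b∈J b≢v)
  ... | no a≢v   | yes refl = uncurry (free a (swap a~b)) (∈slide⇒∈ u∈I v∉I a∈J a≢v)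
  ... | no a≢v   | no b≢v   = I-ind a b (proj₂ (∈slide⇒∈ u∈I v∉I a∈J a≢v)) (proj₂ (∈slide⇒∈ u∈I v∉I b∈J b≢v)) a~b

  slide-independent⁻ : Independent (suc m) (slide I u v) → ∀ {w} → CycleAdj (suc m) v w → w ≢ u → w ∉ I
  slide-independent⁻ J-ind v~w w≢u w∈I = J-ind _ _ target∈slide (∈⇒∈slide u∈I v∉I w∈I w≢u) v~w

module _ {m} (2≤m : 2 ≤ m) {k} {I : Subset (suc m)} (I-vert : IsTSVertex (suc m) k I) where

  private
    I-ind : Independent (suc m) I
    I-ind = proj₁ I-vert

  right-slide-TSEdge : ∀ {u} → u ∈ I → next (next u) ∉ I → TSEdge (suc m) k I (slide I u (next u))
  right-slide-TSEdge {u} u∈I free = slide-TSEdge I-vert u∈I v∉I (CycleAdj-next u)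
    (slide-independent u∈I v∉I (<⇒≤ 2≤m) I-ind only-next)
    where
    v∉I : next u ∉ I
    v∉I = adjacent⇒∉ I-ind u∈I (CycleAdj-next u)
    only-next : ∀ w → CycleAdj (suc m) (next u) w → w ≢ u → w ∉ I
    only-next w v~w w≢u with CycleAdj⇒next⊎prev v~w
    ... | inj₁ refl   = free
    ... | inj₂ w≡prev = ⊥-elim (w≢u (trans w≡prev (prev-next u)))

  left-slide-TSEdge : ∀ {u} → u ∈ I → prev (prev u) ∉ I → TSEdge (suc m) k I (slide I u (prev u))
  left-slide-TSEdge {u} u∈I free = slide-TSEdge I-vert u∈I v∉I (CycleAdj-prev u)
    (slide-independent u∈I v∉I (<⇒≤ 2≤m) I-ind only-prev)
    where
    v∉I : prev u ∉ I
    v∉I = adjacent⇒∉ I-ind u∈I (CycleAdj-prev u)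
    only-prev : ∀ w → CycleAdj (suc m) (prev u) w → w ≢ u → w ∉ I
    only-prev w v~w w≢u with CycleAdj⇒next⊎prev v~w
    ... | inj₁ w≡next = ⊥-elim (w≢u (trans w≡next (next-prev u)))
    ... | inj₂ refl   = free

-- Even degree

module _ {m : ℕ} where

  right-movable left-movable : Subset (suc m) → Subset (suc m)
  right-movable I = I ─ preimage (next ∘ next) I
  left-movable  I = I ─ preimage (prev ∘ prev) I

  ∣right-movable∣≡∣left-movable∣ : ∀ I → ∣ right-movable I ∣ ≡ ∣ left-movable I ∣
  ∣right-movable∣≡∣left-movable∣ I = sym (begin
    ∣ left-movable I ∣
      ≡⟨ ∣preimage∣≡∣p∣ {σ = next²} next²∘prev² prev²∘next² (left-movable I) ⟨
    ∣ preimage next² (I ─ preimage prev² I) ∣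
      ≡⟨ cong ∣_∣ (preimage-─ {σ = next²} I (preimage prev² I)) ⟩
    ∣ preimage next² I ─ preimage next² (preimage prev² I) ∣
      ≡⟨ cong (λ q → ∣ preimage next² I ─ q ∣) (trans (preimage-∘ next² prev² I) (preimage-id prev²∘next² I)) ⟩
    ∣ preimage next² I ─ I ∣
      ≡⟨ ∣p∣≡∣q∣⇒∣p─q∣≡∣q─p∣ {p = preimage next² I} {I} (∣preimage∣≡∣p∣ {σ = next²} next²∘prev² prev²∘next² I) ⟩
    ∣ right-movable I ∣
      ∎)
    where
    open ≡-Reasoning
    next² prev² : Fin (suc m) → Fin (suc m)
    next² = next ∘ next
    prev² = prev ∘ prev
    next²∘prev² : ∀ x → next² (prev² x) ≡ x
    next²∘prev² x = trans (cong next (next-prev (prev x))) (next-prev x)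
    prev²∘next² : ∀ x → prev² (next² x) ≡ x
    prev²∘next² x = trans (cong prev (prev-next (next x))) (prev-next x)

  right-slides left-slides neighbours : Subset (suc m) → List (Subset (suc m))
  right-slides I = List.map (λ u → slide I u (next u)) (elements (right-movable I))
  left-slides  I = List.map (λ u → slide I u (prev u)) (elements (left-movable I))
  neighbours   I = right-slides I ++ left-slides I

  2∣length-neighbours : ∀ I → 2 ∣ length (neighbours I)
  2∣length-neighbours I = divides ∣R∣ (begin
    length (right-slides I ++ left-slides I)
      ≡⟨ length-++ (right-slides I) ⟩
    length (right-slides I) + length (left-slides I)
      ≡⟨ cong₂ _+_ (length-map _ (elements (right-movable I))) (length-map _ (elements (left-movable I))) ⟩
    length (elements (right-movable I)) + length (elements (left-movable I))
      ≡⟨ cong₂ _+_ (length-elements (right-movable I)) (length-elements (left-movable I)) ⟩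
    ∣R∣ + ∣ left-movable I ∣
      ≡⟨ cong (∣R∣ +_) (∣right-movable∣≡∣left-movable∣ I) ⟨
    ∣R∣ + ∣R∣
      ≡⟨ cong (∣R∣ +_) (+-identityʳ ∣R∣) ⟨
    2 * ∣R∣
      ≡⟨ *-comm 2 ∣R∣ ⟩
    ∣R∣ * 2
      ∎)
    where
    open ≡-Reasoning
    ∣R∣ : ℕ
    ∣R∣ = ∣ right-movable I ∣

module _ {m} (2≤m : 2 ≤ m) {k} {I : Subset (suc m)} (I-vert : IsTSVertex (suc m) k I) where

  private
    I-ind : Independent (suc m) I
    I-ind = proj₁ I-vert

    movable⇒∈ : ∀ (σ : Fin (suc m) → Fin (suc m)) {x} → x ∈ˡ elements (I ─ preimage σ I) → x ∈ I
    movable⇒∈ σ x∈ = proj₁ (∈-─preimage⁻ σ {q = I} (∈-elements⁻ x∈))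

    slides-injective : ∀ (f σ : Fin (suc m) → Fin (suc m)) → (∀ u → CycleAdj (suc m) u (f u)) →
                       ∀ {x y} → x ∈ˡ elements (I ─ preimage σ I) → y ∈ˡ elements (I ─ preimage σ I) →
                       slide I x (f x) ≡ slide I y (f y) → x ≡ y
    slides-injective f σ x~f {x} {y} x∈ y∈ eq =
      proj₁ (slide-injective x∈I (adjacent⇒∉ I-ind x∈I (x~f _)) y∈I (adjacent⇒∉ I-ind y∈I (x~f _)) eq)
      where
      x∈I : x ∈ I
      x∈I = movable⇒∈ σ x∈
      y∈I : y ∈ I
      y∈I = movable⇒∈ σ y∈

  neighbours-sound : ∀ {J} → J ∈ˡ neighbours I → TSEdge (suc m) k I J
  neighbours-sound J∈ with ∈-++⁻ (right-slides I) J∈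
  ... | inj₁ J∈R with _ , u∈ , refl ← ∈-map⁻ _ J∈R =
    uncurry (right-slide-TSEdge 2≤m I-vert) (∈-─preimage⁻ (next ∘ next) (∈-elements⁻ u∈))
  ... | inj₂ J∈L with _ , u∈ , refl ← ∈-map⁻ _ J∈L =
    uncurry (left-slide-TSEdge 2≤m I-vert) (∈-─preimage⁻ (prev ∘ prev) (∈-elements⁻ u∈))

  neighbours-complete : ∀ {J} → TSEdge (suc m) k I J → J ∈ˡ neighbours I
  neighbours-complete (_ , (J-ind , _) , (u , v , I─J , J─I , u~v))
    with u∈I , v∉I , refl ← ─≡⁅⁆⇒slide I─J J─I | CycleAdj⇒next⊎prev u~v
  ... | inj₁ refl = ∈-++⁺ˡ (∈-map⁺ _ (∈-elements⁺ (∈-─preimage⁺ (next ∘ next) u∈I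
                      (slide-independent⁻ u∈I v∉I J-ind (CycleAdj-next (next u)) (next∘next≢id 2≤m u)))))
  ... | inj₂ refl = ∈-++⁺ʳ (right-slides I) (∈-map⁺ _ (∈-elements⁺ (∈-─preimage⁺ (prev ∘ prev) u∈I
                      (slide-independent⁻ u∈I v∉I J-ind (CycleAdj-prev (prev u)) (prev∘prev≢id 2≤m u)))))

  neighbours-unique : Unique (neighbours I)
  neighbours-unique =
    Unique.++⁺ (map⁺-injectiveOn (slides-injective next (next ∘ next) CycleAdj-next)
                                 (elements-unique (right-movable I)))
               (map⁺-injectiveOn (slides-injective prev (prev ∘ prev) CycleAdj-prev)
                                 (elements-unique (left-movable I)))
               disjoint
    where
    disjoint : ∀ {J} → ¬ (J ∈ˡ right-slides I × J ∈ˡ left-slides I)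
    disjoint (J∈R , J∈L) with u , u∈ , refl ← ∈-map⁻ _ J∈R | w , w∈ , J≡ ← ∈-map⁻ _ J∈L
      with u∈I ← movable⇒∈ (next ∘ next) u∈ | w∈I ← movable⇒∈ (prev ∘ prev) w∈
      with refl , next≡prev ← slide-injective u∈I (adjacent⇒∉ I-ind u∈I (CycleAdj-next u))
                                              w∈I (adjacent⇒∉ I-ind w∈I (CycleAdj-prev w)) J≡
      = next∘next≢id 2≤m u (trans (cong next next≡prev) (next-prev u))

  even-degree : EvenDegree (suc m) k I
  even-degree = neighbours I , neighbours-unique , (λ _ → mk⇔ neighbours-sound neighbours-complete) ,
                2∣length-neighbours I

-- Connectivity

-- Doubling is written s * 2 rather than 2 * s so that suc s * 2 reduces to suc (suc (s * 2)).

even⊎odd : ∀ x → ∃[ s ] (x ≡ s * 2 ⊎ x ≡ suc (s * 2))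
even⊎odd zero    = 0 , inj₁ refl
even⊎odd (suc x) with even⊎odd x
... | s , inj₁ refl = s , inj₂ refl
... | s , inj₂ refl = suc s , inj₁ refl

even≢odd′ : ∀ r s → r * 2 ≢ suc (s * 2)
even≢odd′ r s eq = even≢odd r s (trans (*-comm 2 r) (trans eq (cong suc (*-comm s 2))))

-- evens t = {0, 2, …, 2t - 2} ∩ Fin n
evens : ℕ → Subset n
evens {zero}        _       = []
evens {suc _}       zero    = ∅
evens {suc zero}    (suc _) = inside ∷ []
evens {suc (suc _)} (suc t) = inside ∷ outside ∷ evens t

∣evens∣ : ∀ {n} t → t * 2 ≤ suc n → ∣ evens {n} t ∣ ≡ t
∣evens∣ {zero}        zero          _                 = refl
∣evens∣ {zero}        (suc t)       (s≤s ())
∣evens∣ {suc n}       zero          _                 = ∣⊥∣≡0 (suc n)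
∣evens∣ {suc zero}    (suc zero)    _                 = refl
∣evens∣ {suc zero}    (suc (suc t)) (s≤s (s≤s ()))
∣evens∣ {suc (suc n)} (suc t)       (s≤s (s≤s 2t≤1+n)) = cong suc (∣evens∣ t 2t≤1+n)

∈-evens⁺ : ∀ {t s} {x : Fin n} → toℕ x ≡ s * 2 → s < t → x ∈ evens t
∈-evens⁺ {suc zero}    {s = zero}  {zero}        _  (s≤s _)   = here
∈-evens⁺ {suc (suc n)} {s = zero}  {zero}        _  (s≤s _)   = here
∈-evens⁺ {suc (suc n)} {s = suc s} {suc (suc x)} eq (s≤s s<t) =
  there (there (∈-evens⁺ (suc-injective (suc-injective eq)) s<t))

∈-evens⁻ : ∀ {t} {x : Fin n} → x ∈ evens t → ∃[ s ] (toℕ x ≡ s * 2 × s < t)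
∈-evens⁻ {suc n}       {zero}  x∈∅  = contradiction x∈∅ ∉⊥
∈-evens⁻ {suc zero}    {suc t} here = 0 , refl , s≤s z≤n
∈-evens⁻ {suc (suc n)} {suc t} here = 0 , refl , s≤s z≤n
∈-evens⁻ {suc (suc n)} {suc t} (there (there x∈)) with s , x≡2s , s<t ← ∈-evens⁻ x∈ =
  suc s , cong (λ y → suc (suc y)) x≡2s , s≤s s<t

evens-independent : ∀ {m t} → t * 2 ≤ m → Independent (suc m) (evens t)
evens-independent {m} {t} 2t≤m x y x∈ y∈ = [ no-succ x∈ y∈ , no-succ y∈ x∈ ]
  where
  no-succ : ∀ {a b} → a ∈ evens t → b ∈ evens t → ¬ CycleSucc (suc m) a b
  no-succ a∈ b∈ a→b with r , a≡2r , r<t ← ∈-evens⁻ {t = t} a∈ | s , b≡2s , _ ← ∈-evens⁻ {t = t} b∈ | a→b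
  ... | inj₁ 1+a≡b         = even≢odd′ s r (trans (sym b≡2s) (trans (sym 1+a≡b) (cong suc a≡2r)))
  ... | inj₂ (1+a≡1+m , _) = <⇒≢ (<-≤-trans (*-monoˡ-< 2 r<t) 2t≤m) (trans (sym a≡2r) (suc-injective 1+a≡1+m))

evens-TSVertex : ∀ {m k} → k * 2 ≤ m → IsTSVertex (suc m) k (evens k)
evens-TSVertex {k = k} 2k≤m = evens-independent {t = k} 2k≤m , ∣evens∣ k (m≤n⇒m≤1+n (m≤n⇒m≤1+n 2k≤m))

LeftStuck : ∀ {m} → Subset (suc m) → Set
LeftStuck I = ∀ u → u ∈ I → u ≢ zero → prev (prev u) ∈ I

module _ {m} {I : Subset (suc m)} (stuck : LeftStuck I) where

  descend : ∀ {u w} s → u ∈ I → toℕ w + s * 2 ≡ toℕ u → w ∈ I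
  descend zero    u∈I w≡u = subst (_∈ I) (sym (toℕ-injective (trans (sym (+-identityʳ _)) w≡u))) u∈I
  descend {u} {w} (suc s) u∈I w+2s+2≡u = descend s (stuck u u∈I u≢zero) (sym (toℕ-prev (toℕ-prev u≡)))
    where
    u≡ : toℕ u ≡ suc (suc (toℕ w + s * 2))
    u≡ = trans (sym w+2s+2≡u) (trans (+-suc _ _) (cong suc (+-suc _ _)))
    u≢zero : u ≢ zero
    u≢zero refl = 0≢1+n u≡

  ladder : ∀ {u w} c {r s} → u ∈ I → toℕ u ≡ c + s * 2 → toℕ w ≡ c + r * 2 → r ≤ s → w ∈ I
  ladder {u} {w} c {r} {s} u∈I u≡ w≡ r≤s = descend (s ∸ r) u∈I (begin
    toℕ w + (s ∸ r) * 2       ≡⟨ cong (_+ (s ∸ r) * 2) w≡ ⟩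
    c + r * 2 + (s ∸ r) * 2   ≡⟨ +-assoc c (r * 2) _ ⟩
    c + (r * 2 + (s ∸ r) * 2) ≡⟨ cong (c +_) (*-distribʳ-+ 2 r (s ∸ r)) ⟨
    c + (r + (s ∸ r)) * 2     ≡⟨ cong (λ x → c + x * 2) (m+[n∸m]≡n r≤s) ⟩
    c + s * 2                 ≡⟨ u≡ ⟨
    toℕ u                     ∎)
    where open ≡-Reasoning

module _ {m k} (1≤m : 1 ≤ m) (1≤k : 1 ≤ k) (2k≤m : k * 2 ≤ m)
         {I : Subset (suc m)} (I-vert : IsTSVertex (suc m) k I) (stuck : LeftStuck I) where

  private
    ∣⊆I∣≤k : ∀ {p} → p ⊆ I → ∣ p ∣ ≤ k
    ∣⊆I∣≤k p⊆I = subst (_ ≤_) (proj₂ I-vert) (p⊆q⇒∣p∣≤∣q∣ p⊆I)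

    odd⇒next-zero∈I : ∀ {u s} → u ∈ I → toℕ u ≡ suc (s * 2) → next zero ∈ I
    odd⇒next-zero∈I {s = s} u∈I u≡ = ladder stuck 1 {0} {s} u∈I u≡ (toℕ-next-zero 1≤m) z≤n

    even⇒evens⊆I : ∀ {u s} → u ∈ I → toℕ u ≡ s * 2 → evens (suc s) ⊆ I
    even⇒evens⊆I {s = s} u∈I u≡ x∈ with r , x≡2r , r<1+s ← ∈-evens⁻ {t = suc s} x∈ =
      ladder stuck 0 {r} {s} u∈I u≡ x≡2r (≤-pred r<1+s)

    odd-last⇒odds⊆I : ∀ {s} → toℕ (fromℕ m) ≡ suc (s * 2) → fromℕ m ∈ I → preimage prev (evens (suc s)) ⊆ I
    odd-last⇒odds⊆I {s} m≡ m∈I {w} w∈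
      with r , prev-w≡2r , r<1+s ← ∈-evens⁻ {t = suc s} (∈-preimage⁻ {σ = prev} w∈) | w
    ... | zero  = ⊥-elim (even≢odd′ r s (trans (sym prev-w≡2r) m≡))
    ... | suc j = ladder stuck 1 {r} {s} m∈I m≡ (cong suc (trans (sym (toℕ-inject₁ j)) prev-w≡2r)) (≤-pred r<1+s)

  -- An odd token descends to 1 and, being stuck, on to m. An even m then descends to 0; an odd m
  -- would put all (m + 1) / 2 > k odd positions into I.
  zero∈I : zero ∈ I
  zero∈I with u , u∈I ← ∣p∣≢0⇒Nonempty (subst (_≢ 0) (sym (proj₂ I-vert)) (>⇒≢ 1≤k)) | even⊎odd (toℕ u)
  ... | s , inj₁ u≡ = ladder stuck 0 {0} {s} u∈I u≡ refl z≤n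
  ... | s , inj₂ u≡
    with last∈I ← subst (_∈ I) (cong prev (prev-next zero))
                        (stuck _ (odd⇒next-zero∈I {s = s} u∈I u≡) (next≢id 1≤m zero))
       | even⊎odd m
  ...   | s′ , inj₁ m≡ = ladder stuck 0 {0} {s′} last∈I (trans (toℕ-fromℕ m) m≡) refl z≤n
  ...   | s′ , inj₂ m≡ = ⊥-elim (1+n≰n (≤-trans (*-monoˡ-≤ 2 1+s′≤k) (subst (k * 2 ≤_) m≡ 2k≤m)))
    where
    odds : Subset (suc m)
    odds = preimage prev (evens (suc s′))
    ∣odds∣≡1+s′ : ∣ odds ∣ ≡ suc s′
    ∣odds∣≡1+s′ = trans (∣preimage∣≡∣p∣ {σ = prev {m}} {next} prev-next next-prev (evens (suc s′)))
                        (∣evens∣ {suc m} (suc s′) (s≤s (s≤s (subst (s′ * 2 ≤_) (sym m≡) (n≤1+n _)))))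
    1+s′≤k : suc s′ ≤ k
    1+s′≤k = subst (_≤ k) ∣odds∣≡1+s′ (∣⊆I∣≤k {odds} (odd-last⇒odds⊆I {s′} (trans (toℕ-fromℕ m) m≡) last∈I))

  I⊆evens : I ⊆ evens k
  I⊆evens {u} u∈I with even⊎odd (toℕ u)
  ... | s , inj₂ u≡ =
    ⊥-elim (proj₁ I-vert zero (next zero) zero∈I (odd⇒next-zero∈I {s = s} u∈I u≡) (CycleAdj-next zero))
  ... | s , inj₁ u≡ with s <? k
  ...   | yes s<k = ∈-evens⁺ u≡ s<k
  ...   | no  s≮k =
    ⊥-elim (s≮k (subst (_≤ k) (∣evens∣ {suc m} (suc s) 2+2s≤2+m) (∣⊆I∣≤k (even⇒evens⊆I {s = s} u∈I u≡))))
    where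
    2+2s≤2+m : suc s * 2 ≤ suc (suc m)
    2+2s≤2+m = s≤s (s≤s (subst (_≤ m) u≡ (≤-pred (toℕ<n u))))

  LeftStuck⇒≡evens : I ≡ evens k
  LeftStuck⇒≡evens =
    p⊆q⇒∣q∣≤∣p∣⇒p≡q I⊆evens (≤-reflexive (trans (proj₂ (evens-TSVertex 2k≤m)) (sym (proj₂ I-vert))))

potential : Subset n → ℕ
potential = weight toℕ

potential-left-slide : ∀ {m} {I : Subset (suc m)} {u} → u ∈ I → prev u ∉ I → u ≢ zero →
                       potential (slide I u (prev u)) < potential I
potential-left-slide {u = zero} _ _ u≢zero = ⊥-elim (u≢zero refl)
potential-left-slide {m} {I} {suc j} u∈I v∉I _ = ≤-reflexive (+-cancelʳ-≡ (toℕ j) _ _ (begin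
  suc (potential J) + toℕ j     ≡⟨ +-suc (potential J) (toℕ j) ⟨
  potential J + suc (toℕ j)     ≡⟨ weight-slide u∈I v∉I toℕ ⟩
  potential I + toℕ (inject₁ j) ≡⟨ cong (potential I +_) (toℕ-inject₁ j) ⟩
  potential I + toℕ j           ∎))
  where
  open ≡-Reasoning
  J : Subset (suc m)
  J = slide I (suc j) (inject₁ j)

module _ {m k} (2≤m : 2 ≤ m) (1≤k : 1 ≤ k) (2k≤m : k * 2 ≤ m) where

  reach-evens : ∀ {I} → IsTSVertex (suc m) k I → Star (TSEdge (suc m) k) I (evens k)
  reach-evens {I} I-vert = go I-vert (<-wellFounded (potential I))
    where
    go : ∀ {I} → IsTSVertex (suc m) k I → Acc _<_ (potential I) → Star (TSEdge (suc m) k) I (evens k)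
    go {I} I-vert (acc smaller) with nonempty? (left-movable I - zero)
    ... | yes (u , u∈) with u∈L , u∉⁅0⁆ ← ∈-─⁻ u∈ with u∈I , prev²u∉I ← ∈-─preimage⁻ (prev ∘ prev) u∈L =
      edge ◅ go (proj₁ (proj₂ edge)) (smaller (potential-left-slide u∈I prev-u∉I (x∉⁅y⁆⇒x≢y u∉⁅0⁆)))
      where
      edge : TSEdge (suc m) k I (slide I u (prev u))
      edge = left-slide-TSEdge 2≤m I-vert u∈I prev²u∉I
      prev-u∉I : prev u ∉ I
      prev-u∉I = adjacent⇒∉ (proj₁ I-vert) u∈I (CycleAdj-prev u)
    ... | no no-left-slide = subst (Star (TSEdge (suc m) k) I) (LeftStuck⇒≡evens (<⇒≤ 2≤m) 1≤k 2k≤m I-vert stuck) ε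
      where
      stuck : LeftStuck I
      stuck u u∈I u≢zero with prev (prev u) ∈? I
      ... | yes prev²u∈I = prev²u∈I
      ... | no  prev²u∉I =
        ⊥-elim (no-left-slide (u , x∈p∧x≢y⇒x∈p-y (∈-─preimage⁺ (prev ∘ prev) u∈I prev²u∉I) u≢zero))

  connected : Connected (suc m) k
  connected = (evens k , evens-TSVertex 2k≤m) ,
              λ I J I-vert J-vert → reach-evens I-vert ◅◅ reverse TSEdge-sym (reach-evens J-vert)

proposition11 : (n k : ℕ) → 3 ≤ n → 1 ≤ k → 2 * k < n → TSEulerian n k
proposition11 (suc m) k (s≤s 2≤m) 1≤k 2k<n =
  connected 2≤m 1≤k (subst (_≤ m) (*-comm 2 k) (≤-pred 2k<n)) , λ I I-vert → even-degree 2≤m I-vert
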